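{- Let $a_1<a_2<a_3$ be positive integers. (i) Suppose $H$ is a graph with an edge-colouring in colours $2$ and $3$ in which every vertex is incident with exactly $a_2$ edges of colour $2$ and $a_3$ edges of colour $3$, such that for every vertex $v$, $e_3[v]<e_2[v]$ (i.e. $H$ is an $(a_2,a_3)$-flip graph), and moreover $e_2[v]<\binom{a_1+1}{2}$ for every vertex $v$. Then $(a_1,a_2,a_3)$ is a $3$-flip sequence. (ii) Suppose $H_1,H_2,H_3$ are graphs that are $a_1$-, $a_2$- and $a_3$-regular respectively, and for $i\in\{1,2\}$, $$\max_{u\in V(H_{i+1})}e[u]<\min_{v\in V(H_i)}e[v].$$ Then $(a_1,a_2,a_3)$ is a $3$-flip sequence.
   Context: All graphs are finite and simple. For an edge-coloured graph, $e_j[v]$ is the number of edges of colour $j$ with both endpoints in $N[v]=N(v)\cup\{v\}$; for an uncoloured graph, $e[u]$ is the number of edges of the subgraph induced by $N[u]$. For a strictly increasing sequence of positive integers $(a_1,a_2,a_3)$, it is a $3$-flip sequence if there is a graph $G$ and an edge-colouring $f:E(G)\to\{1,2,3\}$ such that every vertex is incident with exactly $a_j$ edges of colour $j$ for each $j$, and $e_3[v]<e_2[v]<e_1[v]$ for every vertex $v$. -}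

module Defs where

open import Data.Nat using (ℕ; zero; suc; _+_; _*_; _<_)
open import Data.Bool using (Bool; true; false)
open import Data.Fin using (Fin; zero; suc; toℕ)
open import Data.Fin.Properties using () renaming (_≟_ to _≟F_)
open import Data.Maybe using (Maybe; just; nothing)
open import Data.Product using (Σ; ∃; _×_; _,_)
open import Relation.Nullary using (Dec; yes; no; ¬_)
open import Relation.Binary.PropositionalEquality using (_≡_)
import Data.Nat as ℕ

sumFin : (n : ℕ) → (Fin n → ℕ) → ℕ
sumFin zero    f = 0
sumFin (suc n) f = f zero + sumFin n (λ i → f (suc i))

ind : ∀ {p} {P : Set p} → Dec P → ℕ
ind (yes _) = 1
ind (no  _) = 0

bool : Bool → ℕ
bool true  = 1
bool false = 0

record Graph (n : ℕ) : Set where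
  field
    adj    : Fin n → Fin n → Bool
    sym    : ∀ u v → adj u v ≡ adj v u
    irrefl : ∀ v → adj v v ≡ false
open Graph public

deg : ∀ {n} → Graph n → Fin n → ℕ
deg {n} G v = sumFin n (λ w → bool (adj G v w))

Regular : ∀ {n} → ℕ → Graph n → Set
Regular a G = ∀ v → deg G v ≡ a

inN : ∀ {n} → Graph n → Fin n → Fin n → ℕ
inN G v u with v ≟F u
... | yes _ = 1
... | no  _ = bool (adj G v u)

-- e[v] : number of edges of the subgraph induced by N[v]
-- (each edge {x,y} counted once via toℕ x < toℕ y)
eN : ∀ {n} → Graph n → Fin n → ℕ
eN {n} G v = sumFin n (λ x → sumFin n (λ y →
  ind (toℕ x ℕ.<? toℕ y) * inN G v x * inN G v y * bool (adj G x y)))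

-- Edge-coloured finite simple graphs on Fin n with colours in Fin k.
-- col u v = nothing  means uv is not an edge; just c means an edge of colour c.

record ColouredGraph (k n : ℕ) : Set where
  field
    col    : Fin n → Fin n → Maybe (Fin k)
    sym    : ∀ u v → col u v ≡ col v u
    irrefl : ∀ v → col v v ≡ nothing
open ColouredGraph public

isEdge : ∀ {k} → Maybe (Fin k) → ℕ
isEdge nothing  = 0
isEdge (just _) = 1

hasColour : ∀ {k} → Maybe (Fin k) → Fin k → ℕ
hasColour nothing  j = 0
hasColour (just c) j = ind (c ≟F j)

degC : ∀ {k n} → ColouredGraph k n → Fin k → Fin n → ℕ
degC {n = n} G j v = sumFin n (λ w → hasColour (col G v w) j)

inNC : ∀ {k n} → ColouredGraph k n → Fin n → Fin n → ℕ
inNC G v u with v ≟F u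
... | yes _ = 1
... | no  _ = isEdge (col G v u)

eC : ∀ {k n} → ColouredGraph k n → Fin k → Fin n → ℕ
eC {n = n} G j v = sumFin n (λ x → sumFin n (λ y →
  ind (toℕ x ℕ.<? toℕ y) * inNC G v x * inNC G v y * hasColour (col G x y) j))

-- Colours 1,2,3 are represented by the elements 0,1,2 of Fin 3.

c₁ c₂ c₃ : Fin 3
c₁ = zero
c₂ = suc zero
c₃ = suc (suc zero)

-- (a₁,a₂,a₃) is a 3-flip sequence (strictly increasing positive integers
-- is imposed separately).  Graphs are nonempty: vertex set Fin (suc n).
IsFlip3 : ℕ → ℕ → ℕ → Set
IsFlip3 a₁ a₂ a₃ = Σ ℕ λ n → Σ (ColouredGraph 3 (suc n)) λ G →
  (∀ v → degC G c₁ v ≡ a₁ × degC G c₂ v ≡ a₂ × degC G c₃ v ≡ a₃) ×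
  (∀ v → eC G c₃ v < eC G c₂ v × eC G c₂ v < eC G c₁ v)

-- For part (i): colours 2 and 3 are represented by 0 and 1 of Fin 2.
d₂ d₃ : Fin 2
d₂ = zero
d₃ = suc zero

-- The construction is a Cartesian product.  In G □ H the closed neighbourhood of (g,h)
-- is {g} × N[h] ∪ N[g] × {h}, and an edge inside it either lies in the fibre {g} × H, where
-- it is an edge of H inside N[h], or in the fibre G × {h}, where it is an edge of G inside
-- N[g].  Hence colour degrees and the numbers e_j add over the factors.  For (i) take
-- K_{a₁+1} in colour 1 times H in colours 2 and 3: every vertex then has e₁ = C(a₁+1, 2).
-- For (ii) take H₁, H₂, H₃ in colours 1, 2, 3.
module Submission where

open import Defs hiding (sym)
open import Data.Nat using (ℕ; zero; suc; _+_; _*_; _<_)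
import Data.Nat as ℕ
open import Data.Nat.Properties
  using (+-comm; +-assoc; +-identityʳ; *-comm; *-assoc; *-identityʳ; *-zeroʳ;
         *-distribˡ-+; *-distribʳ-+; +-cancelʳ-≡; *-cancelʳ-≡; <-cmp)
open import Data.Nat.Combinatorics using (_C_; nCk+nC[k+1]≡[n+1]C[k+1]; nC1≡n)
open import Data.Nat.Tactic.RingSolver using (solve-∀)
open import Data.Bool using (Bool; true; false; not)
open import Data.Fin using (Fin; zero; suc; toℕ; combine; remQuot; _↑ˡ_; _↑ʳ_)
open import Data.Fin.Properties
  using (toℕ-injective; remQuot-combine; combine-remQuot; combine-injectiveˡ; combine-injectiveʳ)
  renaming (_≟_ to _≟F_)
open import Data.Maybe using (Maybe; just; nothing)
import Data.Maybe as Maybe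
open import Data.Product using (_×_; _,_; proj₁; proj₂)
open import Data.Empty using (⊥-elim)
open import Function using (_∘_)
open import Relation.Nullary using (Dec; yes; no; ¬_; does)
open import Relation.Nullary.Decidable using (dec-true; dec-false)
open import Relation.Binary using (tri<; tri≈; tri>)
open import Relation.Binary.PropositionalEquality
  using (_≡_; _≢_; refl; sym; trans; cong; cong₂; subst; subst₂; module ≡-Reasoning)

open ≡-Reasoning

sumFin-cong : ∀ n {f g : Fin n → ℕ} → (∀ i → f i ≡ g i) → sumFin n f ≡ sumFin n g
sumFin-cong zero    f≗g = refl
sumFin-cong (suc n) f≗g = cong₂ _+_ (f≗g zero) (sumFin-cong n (f≗g ∘ suc))

sumFin-zero : ∀ n {f : Fin n → ℕ} → (∀ i → f i ≡ 0) → sumFin n f ≡ 0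
sumFin-zero zero    f≗0 = refl
sumFin-zero (suc n) f≗0 = cong₂ _+_ (f≗0 zero) (sumFin-zero n (f≗0 ∘ suc))

sumFin-const : ∀ n c → sumFin n (λ _ → c) ≡ n * c
sumFin-const zero    c = refl
sumFin-const (suc n) c = cong (c +_) (sumFin-const n c)

sumFin-+ : ∀ n (f g : Fin n → ℕ) → sumFin n (λ i → f i + g i) ≡ sumFin n f + sumFin n g
sumFin-+ zero    f g = refl
sumFin-+ (suc n) f g = begin
  f zero + g zero + sumFin n (λ i → f (suc i) + g (suc i))
    ≡⟨ cong (f zero + g zero +_) (sumFin-+ n (f ∘ suc) (g ∘ suc)) ⟩
  f zero + g zero + (sumFin n (f ∘ suc) + sumFin n (g ∘ suc))
    ≡⟨ +-+-rearrange (f zero) (g zero) _ _ ⟩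
  f zero + sumFin n (f ∘ suc) + (g zero + sumFin n (g ∘ suc)) ∎
  where
  +-+-rearrange : ∀ a b c d → a + b + (c + d) ≡ a + c + (b + d)
  +-+-rearrange = solve-∀

sumFin-*ˡ : ∀ n c (f : Fin n → ℕ) → sumFin n (λ i → c * f i) ≡ c * sumFin n f
sumFin-*ˡ zero    c f = sym (*-zeroʳ c)
sumFin-*ˡ (suc n) c f = trans (cong (c * f zero +_) (sumFin-*ˡ n c (f ∘ suc)))
                              (sym (*-distribˡ-+ c (f zero) _))

sumFin-comm : ∀ m n (f : Fin m → Fin n → ℕ) →
  sumFin m (λ i → sumFin n (f i)) ≡ sumFin n (λ j → sumFin m (λ i → f i j))
sumFin-comm zero    n f = sym (sumFin-zero n (λ _ → refl))
sumFin-comm (suc m) n f = trans (cong (sumFin n (f zero) +_) (sumFin-comm m n (f ∘ suc)))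
                                (sym (sumFin-+ n (f zero) _))

sumFin-↑ : ∀ m n (f : Fin (m + n) → ℕ) →
  sumFin (m + n) f ≡ sumFin m (λ i → f (i ↑ˡ n)) + sumFin n (λ j → f (m ↑ʳ j))
sumFin-↑ zero    n f = refl
sumFin-↑ (suc m) n f = trans (cong (f zero +_) (sumFin-↑ m n (f ∘ suc))) (sym (+-assoc (f zero) _ _))

sumFin-combine : ∀ m n (f : Fin (m * n) → ℕ) →
  sumFin (m * n) f ≡ sumFin m (λ i → sumFin n (λ j → f (combine i j)))
sumFin-combine zero    n f = refl
sumFin-combine (suc m) n f = trans (sumFin-↑ n (m * n) f) (cong (sumFin n (λ j → f (j ↑ˡ m * n)) +_) (sumFin-combine m n (f ∘ (n ↑ʳ_))))

ind-yes : ∀ {p} {P : Set p} (P? : Dec P) → P → ind P? ≡ 1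
ind-yes (yes _) _ = refl
ind-yes (no ¬p) p = ⊥-elim (¬p p)

ind-no : ∀ {p} {P : Set p} (P? : Dec P) → ¬ P → ind P? ≡ 0
ind-no (yes p) ¬p = ⊥-elim (¬p p)
ind-no (no _)  _  = refl

δ : ∀ {n} → Fin n → Fin n → ℕ
δ a b = ind (a ≟F b)

δ-refl : ∀ {n} (a : Fin n) → δ a a ≡ 1
δ-refl a = ind-yes (a ≟F a) refl

δ-≢ : ∀ {n} {a b : Fin n} → a ≢ b → δ a b ≡ 0
δ-≢ {a = a} {b} = ind-no (a ≟F b)

δ-suc : ∀ {n} (a b : Fin n) → δ (suc a) (suc b) ≡ δ a b
δ-suc a b with a ≟F b
... | yes _ = refl
... | no  _ = refl

sumFin-δ : ∀ n (a : Fin n) (f : Fin n → ℕ) → sumFin n (λ i → δ a i * f i) ≡ f a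
sumFin-δ (suc n) zero    f = trans (cong (f zero + 0 +_) (sumFin-zero n (λ _ → refl))) (trans (+-identityʳ _) (+-identityʳ _))
sumFin-δ (suc n) (suc a) f = trans (sumFin-cong n (λ i → cong (_* f (suc i)) (δ-suc a i))) (sumFin-δ n a (f ∘ suc))

sumFin² : (n : ℕ) → (Fin n → Fin n → ℕ) → ℕ
sumFin² n F = sumFin n (λ x → sumFin n (λ y → F x y))

sumFin²-cong : ∀ n {F G : Fin n → Fin n → ℕ} → (∀ x y → F x y ≡ G x y) → sumFin² n F ≡ sumFin² n G
sumFin²-cong n F≗G = sumFin-cong n (λ x → sumFin-cong n (F≗G x))

sumFin²-+ : ∀ n (F G : Fin n → Fin n → ℕ) →
  sumFin² n (λ x y → F x y + G x y) ≡ sumFin² n F + sumFin² n G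
sumFin²-+ n F G = trans (sumFin-cong n (λ x → sumFin-+ n (F x) (G x))) (sumFin-+ n _ _)

sumFin²-*ˡ : ∀ n c (F : Fin n → Fin n → ℕ) → sumFin² n (λ x y → c * F x y) ≡ c * sumFin² n F
sumFin²-*ˡ n c F = trans (sumFin-cong n (λ x → sumFin-*ˡ n c (F x))) (sumFin-*ˡ n c _)

sumFin²-δδ : ∀ n (a : Fin n) c → sumFin² n (λ x y → δ a x * (δ a y * c)) ≡ c
sumFin²-δδ n a c = begin
  sumFin² n (λ x y → δ a x * (δ a y * c))       ≡⟨ sumFin-cong n (λ x → sumFin-*ˡ n (δ a x) _) ⟩
  sumFin n (λ x → δ a x * sumFin n (λ y → δ a y * c)) ≡⟨ sumFin-cong n (λ x → cong (δ a x *_) (sumFin-δ n a _)) ⟩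
  sumFin n (λ x → δ a x * c)                     ≡⟨ sumFin-δ n a _ ⟩
  c                                              ∎

sumFin²-combine : ∀ m n (F : Fin (m * n) → Fin (m * n) → ℕ) →
  sumFin² (m * n) F ≡
  sumFin² m (λ x₁ y₁ → sumFin² n (λ x₂ y₂ → F (combine x₁ x₂) (combine y₁ y₂)))
sumFin²-combine m n F = begin
  sumFin² (m * n) F
    ≡⟨ sumFin-combine m n _ ⟩
  sumFin m (λ x₁ → sumFin n (λ x₂ → sumFin (m * n) (F (combine x₁ x₂))))
    ≡⟨ sumFin-cong m (λ x₁ → sumFin-cong n (λ x₂ → sumFin-combine m n _)) ⟩
  sumFin m (λ x₁ → sumFin n (λ x₂ → sumFin m (λ y₁ → sumFin n (λ y₂ → F (combine x₁ x₂) (combine y₁ y₂)))))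
    ≡⟨ sumFin-cong m (λ x₁ → sumFin-comm n m _) ⟩
  sumFin² m (λ x₁ y₁ → sumFin² n (λ x₂ y₂ → F (combine x₁ x₂) (combine y₁ y₂))) ∎

_<ᵢ_ : ∀ {n} → Fin n → Fin n → ℕ
x <ᵢ y = ind (toℕ x ℕ.<? toℕ y)

<ᵢ-split : ∀ {n} (F : Fin n → Fin n → ℕ) → (∀ x y → F x y ≡ F y x) → (∀ x → F x x ≡ 0) →
  ∀ x y → F x y ≡ (x <ᵢ y) * F x y + (y <ᵢ x) * F y x
<ᵢ-split F F-sym F-diag x y with <-cmp (toℕ x) (toℕ y)
... | tri< x<y _ y≮x rewrite ind-yes (toℕ x ℕ.<? toℕ y) x<y | ind-no (toℕ y ℕ.<? toℕ x) y≮x =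
  sym (trans (+-identityʳ _) (+-identityʳ _))
... | tri> x≮y _ y<x rewrite ind-no (toℕ x ℕ.<? toℕ y) x≮y | ind-yes (toℕ y ℕ.<? toℕ x) y<x =
  trans (F-sym x y) (sym (+-identityʳ _))
... | tri≈ x≮y x≡y y≮x rewrite ind-no (toℕ x ℕ.<? toℕ y) x≮y | ind-no (toℕ y ℕ.<? toℕ x) y≮x
                              | toℕ-injective {i = x} {j = y} x≡y = F-diag y

sumFin²-<ᵢ : ∀ n (F : Fin n → Fin n → ℕ) → (∀ x y → F x y ≡ F y x) → (∀ x → F x x ≡ 0) →
  sumFin² n (λ x y → (x <ᵢ y) * F x y) * 2 ≡ sumFin² n F
sumFin²-<ᵢ n F F-sym F-diag = sym (begin
  sumFin² n F
    ≡⟨ sumFin²-cong n (<ᵢ-split F F-sym F-diag) ⟩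
  sumFin² n (λ x y → (x <ᵢ y) * F x y + (y <ᵢ x) * F y x)
    ≡⟨ sumFin²-+ n _ _ ⟩
  S + sumFin² n (λ x y → (y <ᵢ x) * F y x)
    ≡⟨ cong (S +_) (sumFin-comm n n _) ⟩
  S + S
    ≡⟨ cong (S +_) (sym (+-identityʳ S)) ⟩
  2 * S
    ≡⟨ *-comm 2 S ⟩
  S * 2 ∎)
  where
  S = sumFin² n (λ x y → (x <ᵢ y) * F x y)

inNC≡δ+isEdge : ∀ {k n} (G : ColouredGraph k n) v u → inNC G v u ≡ δ v u + isEdge (col G v u)
inNC≡δ+isEdge G v u with v ≟F u
... | yes refl rewrite ColouredGraph.irrefl G v = refl
... | no  _    = refl

δδ-≢ : ∀ {n} (a : Fin n) {x y} → x ≢ y → ∀ c → δ a x * (δ a y * c) ≡ 0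
δδ-≢ a {x} {y} x≢y c with a ≟F x
... | yes refl rewrite δ-≢ x≢y = refl
... | no  _    = refl

-- Only x = y = a survives the deltas, and there is no loop at a.
δδ-loop : ∀ {k n} (G : ColouredGraph k n) (w : Maybe (Fin k) → ℕ) → w nothing ≡ 0 →
  ∀ a x y → δ a x * δ a y * w (col G x y) ≡ 0
δδ-loop G w w₀ a x y with a ≟F x | a ≟F y
... | yes refl | yes refl rewrite ColouredGraph.irrefl G a | w₀ = refl
... | yes refl | no _     = refl
... | no _     | _        = refl

δδ-loop-scaled : ∀ {k l} (F : ColouredGraph k l) (w : Maybe (Fin k) → ℕ) → w nothing ≡ 0 →
  ∀ a x y e → δ a x * e * (δ a y * e) * (1 * w (col F x y)) ≡ 0
δδ-loop-scaled F w w₀ a x y e = begin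
  δ a x * e * (δ a y * e) * (1 * w (col F x y)) ≡⟨ reorder (δ a x) (δ a y) e _ ⟩
  e * e * (δ a x * δ a y * w (col F x y))       ≡⟨ cong (e * e *_) (δδ-loop F w w₀ a x y) ⟩
  e * e * 0                                     ≡⟨ *-zeroʳ (e * e) ⟩
  0                                             ∎
  where
  reorder : ∀ a b e c → a * e * (b * e) * (1 * c) ≡ e * e * (a * b * c)
  reorder = solve-∀

π₁ : ∀ {m} n → Fin (m * n) → Fin m
π₁ {m} n u = proj₁ (remQuot {m} n u)

π₂ : ∀ {m} n → Fin (m * n) → Fin n
π₂ {m} n u = proj₂ (remQuot {m} n u)

closedEdge : ∀ {k n} → ColouredGraph k n → Fin k → Fin n → Fin n → Fin n → ℕ
closedEdge G j v x y = inNC G v x * inNC G v y * hasColour (col G x y) j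

eC*2≡sumFin²-closedEdge : ∀ {k n} (G : ColouredGraph k n) j v → eC G j v * 2 ≡ sumFin² n (closedEdge G j v)
eC*2≡sumFin²-closedEdge {n = n} G j v =
  trans (cong (_* 2) (sumFin²-cong n (λ x y → *-assoc³ (x <ᵢ y) (inNC G v x) (inNC G v y) _)))
        (sumFin²-<ᵢ n (closedEdge G j v) closedEdge-sym closedEdge-diag)
  where
  *-assoc³ : ∀ a b c d → a * b * c * d ≡ a * (b * c * d)
  *-assoc³ = solve-∀
  closedEdge-sym : ∀ x y → closedEdge G j v x y ≡ closedEdge G j v y x
  closedEdge-sym x y = cong₂ _*_ (*-comm (inNC G v x) _) (cong (λ c → hasColour c j) (ColouredGraph.sym G x y))
  closedEdge-diag : ∀ x → closedEdge G j v x x ≡ 0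
  closedEdge-diag x rewrite ColouredGraph.irrefl G x = *-zeroʳ (inNC G v x * inNC G v x)

module _ {k m n : ℕ} (G : ColouredGraph k m) (H : ColouredGraph k n) where

  □-col : Fin m → Fin n → Fin m → Fin n → Maybe (Fin k)
  □-col g h g' h' with g ≟F g' | h ≟F h'
  ... | yes _ | _     = col H h h'
  ... | no  _ | yes _ = col G g g'
  ... | no  _ | no  _ = nothing

  □-col-sym : ∀ g h g' h' → □-col g h g' h' ≡ □-col g' h' g h
  □-col-sym g h g' h' with g ≟F g' | h ≟F h' | g' ≟F g | h' ≟F h
  ... | yes _    | _        | yes _    | _     = ColouredGraph.sym H h h'
  ... | yes g≡g' | _        | no g'≢g  | _     = ⊥-elim (g'≢g (sym g≡g'))
  ... | no g≢g'  | _        | yes g'≡g | _     = ⊥-elim (g≢g' (sym g'≡g))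
  ... | no _     | yes _    | no _     | yes _ = ColouredGraph.sym G g g'
  ... | no _     | yes h≡h' | no _     | no h'≢h = ⊥-elim (h'≢h (sym h≡h'))
  ... | no _     | no h≢h'  | no _     | yes h'≡h = ⊥-elim (h≢h' (sym h'≡h))
  ... | no _     | no _     | no _     | no _  = refl

  □-col-irrefl : ∀ g h → □-col g h g h ≡ nothing
  □-col-irrefl g h with g ≟F g
  ... | yes _  = ColouredGraph.irrefl H h
  ... | no g≢g = ⊥-elim (g≢g refl)

  □-col-weight : (w : Maybe (Fin k) → ℕ) → w nothing ≡ 0 → ∀ g h g' h' →
    w (□-col g h g' h') ≡ δ g g' * w (col H h h') + δ h h' * w (col G g g')
  □-col-weight w w₀ g h g' h' with g ≟F g' | h ≟F h'
  ... | yes refl | h≟h'     rewrite ColouredGraph.irrefl G g | w₀ = x≡[x+0]+y*0 (w (col H h h')) (ind h≟h')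
    where
    x≡[x+0]+y*0 : ∀ x y → x ≡ x + 0 + y * 0
    x≡[x+0]+y*0 = solve-∀
  ... | no _     | yes refl = sym (+-identityʳ _)
  ... | no _     | no _     = w₀

  _□_ : ColouredGraph k (m * n)
  _□_ = record
    { col    = λ u w → □-col (π₁ {m} n u) (π₂ {m} n u) (π₁ {m} n w) (π₂ {m} n w)
    ; sym    = λ u w → □-col-sym (π₁ {m} n u) (π₂ {m} n u) (π₁ {m} n w) (π₂ {m} n w)
    ; irrefl = λ u → □-col-irrefl (π₁ {m} n u) (π₂ {m} n u)
    }

module _ {k m n : ℕ} (G : ColouredGraph k m) (H : ColouredGraph k n) where

  col-□-combine : ∀ g h g' h' → col (G □ H) (combine g h) (combine g' h') ≡ □-col G H g h g' h'
  col-□-combine g h g' h' =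
    cong₂ (λ p q → □-col G H (proj₁ p) (proj₂ p) (proj₁ q) (proj₂ q))
          (remQuot-combine {k = n} g h) (remQuot-combine {k = n} g' h')

  δ-combine : ∀ (g g' : Fin m) (h h' : Fin n) → δ (combine g h) (combine g' h') ≡ δ g g' * δ h h'
  δ-combine g g' h h' with combine g h ≟F combine g' h' | g ≟F g' | h ≟F h'
  ... | yes _ | yes _    | yes _ = refl
  ... | yes e | no g≢g'  | _     = ⊥-elim (g≢g' (combine-injectiveˡ g h g' h' e))
  ... | yes e | yes _    | no h≢h' = ⊥-elim (h≢h' (combine-injectiveʳ g h g' h' e))
  ... | no c≢c' | yes refl | yes refl = ⊥-elim (c≢c' refl)
  ... | no _  | yes _    | no _  = refl
  ... | no _  | no _     | _     = refl

  inNC-□ : ∀ g h x₁ x₂ → inNC (G □ H) (combine g h) (combine x₁ x₂) ≡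
           δ g x₁ * δ h x₂ + (δ g x₁ * isEdge (col H h x₂) + δ h x₂ * isEdge (col G g x₁))
  inNC-□ g h x₁ x₂ = trans (inNC≡δ+isEdge (G □ H) _ _)
    (cong₂ _+_ (δ-combine g x₁ h x₂) (trans (cong isEdge (col-□-combine g h x₁ x₂))
                                            (□-col-weight G H isEdge refl g h x₁ x₂)))

  inNC-□-fibre : ∀ g h x₂ → inNC (G □ H) (combine g h) (combine g x₂) ≡ inNC H h x₂
  inNC-□-fibre g h x₂
    rewrite inNC-□ g h g x₂ | δ-refl g | ColouredGraph.irrefl G g | inNC≡δ+isEdge H h x₂ =
    simplify (δ h x₂) (isEdge (col H h x₂))
    where
    simplify : ∀ a b → 1 * a + (1 * b + a * 0) ≡ a + b
    simplify = solve-∀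

  inNC-□-offFibre : ∀ {g x₁} h x₂ → g ≢ x₁ →
    inNC (G □ H) (combine g h) (combine x₁ x₂) ≡ δ h x₂ * isEdge (col G g x₁)
  inNC-□-offFibre {g} {x₁} h x₂ g≢x₁ rewrite inNC-□ g h x₁ x₂ | δ-≢ g≢x₁ = refl

  inNC-□-row : ∀ g h x₁ → inNC (G □ H) (combine g h) (combine x₁ h) ≡ inNC G g x₁
  inNC-□-row g h x₁
    rewrite inNC-□ g h x₁ h | δ-refl h | ColouredGraph.irrefl H h | inNC≡δ+isEdge G g x₁ =
    simplify (δ g x₁) (isEdge (col G g x₁))
    where
    simplify : ∀ a b → a * 1 + (a * 0 + 1 * b) ≡ a + b
    simplify = solve-∀

  inNC-□-offRow : ∀ g {h x₂} x₁ → h ≢ x₂ →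
    inNC (G □ H) (combine g h) (combine x₁ x₂) ≡ δ g x₁ * isEdge (col H h x₂)
  inNC-□-offRow g {h} {x₂} x₁ h≢x₂ rewrite inNC-□ g h x₁ x₂ | δ-≢ h≢x₂ =
    simplify (δ g x₁) (isEdge (col H h x₂))
    where
    simplify : ∀ a b → a * 0 + (a * b + 0) ≡ a * b
    simplify = solve-∀

  private
    unit-factors : ∀ a b c → a * b * (1 * c) ≡ 1 * (1 * (a * b * c))
    unit-factors = solve-∀

  closedEdge-□-fibre : ∀ j g h x₁ x₂ y₁ y₂ →
    inNC (G □ H) (combine g h) (combine x₁ x₂) * inNC (G □ H) (combine g h) (combine y₁ y₂) *
      (δ x₁ y₁ * hasColour (col H x₂ y₂) j)
    ≡ δ g x₁ * (δ g y₁ * closedEdge H j h x₂ y₂)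
  closedEdge-□-fibre j g h x₁ x₂ y₁ y₂ with x₁ ≟F y₁
  ... | no x₁≢y₁ = trans (*-zeroʳ (inNC (G □ H) (combine g h) (combine x₁ x₂) * inNC (G □ H) (combine g h) (combine y₁ y₂)))
                         (sym (δδ-≢ g x₁≢y₁ (closedEdge H j h x₂ y₂)))
  ... | yes refl with g ≟F x₁
  ...   | yes refl rewrite inNC-□-fibre g h x₂ | inNC-□-fibre g h y₂ =
    unit-factors (inNC H h x₂) (inNC H h y₂) (hasColour (col H x₂ y₂) j)
  ...   | no g≢x₁ rewrite inNC-□-offFibre h x₂ g≢x₁ | inNC-□-offFibre h y₂ g≢x₁ =
    δδ-loop-scaled H (λ c → hasColour c j) refl h x₂ y₂ (isEdge (col G g x₁))

  closedEdge-□-row : ∀ j g h x₁ x₂ y₁ y₂ →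
    inNC (G □ H) (combine g h) (combine x₁ x₂) * inNC (G □ H) (combine g h) (combine y₁ y₂) *
      (δ x₂ y₂ * hasColour (col G x₁ y₁) j)
    ≡ δ h x₂ * (δ h y₂ * closedEdge G j g x₁ y₁)
  closedEdge-□-row j g h x₁ x₂ y₁ y₂ with x₂ ≟F y₂
  ... | no x₂≢y₂ = trans (*-zeroʳ (inNC (G □ H) (combine g h) (combine x₁ x₂) * inNC (G □ H) (combine g h) (combine y₁ y₂)))
                         (sym (δδ-≢ h x₂≢y₂ (closedEdge G j g x₁ y₁)))
  ... | yes refl with h ≟F x₂
  ...   | yes refl rewrite inNC-□-row g h x₁ | inNC-□-row g h y₁ =
    unit-factors (inNC G g x₁) (inNC G g y₁) (hasColour (col G x₁ y₁) j)
  ...   | no h≢x₂ rewrite inNC-□-offRow g x₁ h≢x₂ | inNC-□-offRow g y₁ h≢x₂ =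
    δδ-loop-scaled G (λ c → hasColour c j) refl g x₁ y₁ (isEdge (col H h x₂))

  closedEdge-□ : ∀ j g h x₁ x₂ y₁ y₂ →
    closedEdge (G □ H) j (combine g h) (combine x₁ x₂) (combine y₁ y₂)
    ≡ δ h x₂ * (δ h y₂ * closedEdge G j g x₁ y₁) + δ g x₁ * (δ g y₁ * closedEdge H j h x₂ y₂)
  closedEdge-□ j g h x₁ x₂ y₁ y₂ = begin
    N x₁ x₂ * N y₁ y₂ * hasColour (col (G □ H) (combine x₁ x₂) (combine y₁ y₂)) j
      ≡⟨ cong (N x₁ x₂ * N y₁ y₂ *_) (trans (cong (λ c → hasColour c j) (col-□-combine x₁ x₂ y₁ y₂))
                                             (□-col-weight G H (λ c → hasColour c j) refl x₁ x₂ y₁ y₂)) ⟩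
    N x₁ x₂ * N y₁ y₂ * (δ x₁ y₁ * hasColour (col H x₂ y₂) j + δ x₂ y₂ * hasColour (col G x₁ y₁) j)
      ≡⟨ *-distribˡ-+ (N x₁ x₂ * N y₁ y₂) _ _ ⟩
    N x₁ x₂ * N y₁ y₂ * (δ x₁ y₁ * hasColour (col H x₂ y₂) j) + N x₁ x₂ * N y₁ y₂ * (δ x₂ y₂ * hasColour (col G x₁ y₁) j)
      ≡⟨ cong₂ _+_ (closedEdge-□-fibre j g h x₁ x₂ y₁ y₂) (closedEdge-□-row j g h x₁ x₂ y₁ y₂) ⟩
    δ g x₁ * (δ g y₁ * closedEdge H j h x₂ y₂) + δ h x₂ * (δ h y₂ * closedEdge G j g x₁ y₁)
      ≡⟨ +-comm (δ g x₁ * (δ g y₁ * closedEdge H j h x₂ y₂)) _ ⟩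
    δ h x₂ * (δ h y₂ * closedEdge G j g x₁ y₁) + δ g x₁ * (δ g y₁ * closedEdge H j h x₂ y₂) ∎
    where
    N : Fin m → Fin n → ℕ
    N x₁ x₂ = inNC (G □ H) (combine g h) (combine x₁ x₂)

  sumFin²-closedEdge-□ : ∀ j g h → sumFin² (m * n) (closedEdge (G □ H) j (combine g h)) ≡
                                   sumFin² m (closedEdge G j g) + sumFin² n (closedEdge H j h)
  sumFin²-closedEdge-□ j g h = begin
    sumFin² (m * n) (closedEdge (G □ H) j (combine g h))
      ≡⟨ sumFin²-combine m n _ ⟩
    sumFin² m (λ x₁ y₁ → sumFin² n (λ x₂ y₂ → closedEdge (G □ H) j (combine g h) (combine x₁ x₂) (combine y₁ y₂)))
      ≡⟨ sumFin²-cong m (λ x₁ y₁ → sumFin²-cong n (λ x₂ y₂ → closedEdge-□ j g h x₁ x₂ y₁ y₂)) ⟩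
    sumFin² m (λ x₁ y₁ → sumFin² n (λ x₂ y₂ → δ h x₂ * (δ h y₂ * EG x₁ y₁) + δ g x₁ * (δ g y₁ * EH x₂ y₂)))
      ≡⟨ sumFin²-cong m (λ x₁ y₁ → trans (sumFin²-+ n _ _) (cong₂ _+_ (sumFin²-δδ n h _) (inner x₁ y₁))) ⟩
    sumFin² m (λ x₁ y₁ → EG x₁ y₁ + δ g x₁ * (δ g y₁ * sumFin² n EH))
      ≡⟨ trans (sumFin²-+ m _ _) (cong (sumFin² m EG +_) (sumFin²-δδ m g _)) ⟩
    sumFin² m EG + sumFin² n EH ∎
    where
    EG = closedEdge G j g
    EH = closedEdge H j h
    inner : ∀ x₁ y₁ → sumFin² n (λ x₂ y₂ → δ g x₁ * (δ g y₁ * EH x₂ y₂)) ≡ δ g x₁ * (δ g y₁ * sumFin² n EH)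
    inner x₁ y₁ = trans (sumFin²-*ˡ n (δ g x₁) _) (cong (δ g x₁ *_) (sumFin²-*ˡ n (δ g y₁) EH))

  eC-□-combine : ∀ j g h → eC (G □ H) j (combine g h) ≡ eC G j g + eC H j h
  eC-□-combine j g h = *-cancelʳ-≡ _ _ 2 (begin
    eC (G □ H) j (combine g h) * 2                             ≡⟨ eC*2≡sumFin²-closedEdge (G □ H) j (combine g h) ⟩
    sumFin² (m * n) (closedEdge (G □ H) j (combine g h))       ≡⟨ sumFin²-closedEdge-□ j g h ⟩
    sumFin² m (closedEdge G j g) + sumFin² n (closedEdge H j h) ≡⟨ cong₂ _+_ (eC*2≡sumFin²-closedEdge G j g)
                                                                             (eC*2≡sumFin²-closedEdge H j h) ⟨
    eC G j g * 2 + eC H j h * 2                                ≡⟨ *-distribʳ-+ 2 (eC G j g) _ ⟨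
    (eC G j g + eC H j h) * 2                                  ∎)

  degC-□-combine : ∀ j g h → degC (G □ H) j (combine g h) ≡ degC G j g + degC H j h
  degC-□-combine j g h = begin
    degC (G □ H) j (combine g h)
      ≡⟨ sumFin-combine m n _ ⟩
    sumFin m (λ x₁ → sumFin n (λ x₂ → hasColour (col (G □ H) (combine g h) (combine x₁ x₂)) j))
      ≡⟨ sumFin-cong m (λ x₁ → sumFin-cong n (λ x₂ →
           trans (cong (λ c → hasColour c j) (col-□-combine g h x₁ x₂)) (□-col-weight G H (λ c → hasColour c j) refl g h x₁ x₂))) ⟩
    sumFin m (λ x₁ → sumFin n (λ x₂ → δ g x₁ * hasColour (col H h x₂) j + δ h x₂ * hasColour (col G g x₁) j))
      ≡⟨ sumFin-cong m (λ x₁ → trans (sumFin-+ n _ _) (cong₂ _+_ (sumFin-*ˡ n (δ g x₁) _) (sumFin-δ n h _))) ⟩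
    sumFin m (λ x₁ → δ g x₁ * degC H j h + hasColour (col G g x₁) j)
      ≡⟨ trans (sumFin-+ m _ _) (cong (_+ degC G j g) (sumFin-δ m g _)) ⟩
    degC H j h + degC G j g
      ≡⟨ +-comm (degC H j h) _ ⟩
    degC G j g + degC H j h ∎

  eC-□ : ∀ j u → eC (G □ H) j u ≡ eC G j (π₁ {m} n u) + eC H j (π₂ {m} n u)
  eC-□ j u = subst (λ w → eC (G □ H) j w ≡ eC G j (π₁ {m} n u) + eC H j (π₂ {m} n u))
                   (combine-remQuot {m} n u) (eC-□-combine j (π₁ {m} n u) (π₂ {m} n u))

  degC-□ : ∀ j u → degC (G □ H) j u ≡ degC G j (π₁ {m} n u) + degC H j (π₂ {m} n u)
  degC-□ j u = subst (λ w → degC (G □ H) j w ≡ degC G j (π₁ {m} n u) + degC H j (π₂ {m} n u))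
                     (combine-remQuot {m} n u) (degC-□-combine j (π₁ {m} n u) (π₂ {m} n u))

edgeColour : ∀ {k} → Fin k → Bool → Maybe (Fin k)
edgeColour c true  = just c
edgeColour c false = nothing

monochrome : ∀ {k n} → Fin k → Graph n → ColouredGraph k n
monochrome c G = record
  { col    = λ u v → edgeColour c (adj G u v)
  ; sym    = λ u v → cong (edgeColour c) (Graph.sym G u v)
  ; irrefl = λ v → cong (edgeColour c) (Graph.irrefl G v)
  }

module _ {k n} (c : Fin k) (G : Graph n) where

  isEdge-edgeColour : ∀ b → isEdge (edgeColour c b) ≡ bool b
  isEdge-edgeColour true  = refl
  isEdge-edgeColour false = refl

  inNC-monochrome : ∀ v u → inNC (monochrome c G) v u ≡ inN G v u
  inNC-monochrome v u with v ≟F u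
  ... | yes _ = refl
  ... | no  _ = isEdge-edgeColour (adj G v u)

  hasColour-edgeColour : ∀ b → hasColour (edgeColour c b) c ≡ bool b
  hasColour-edgeColour true  = δ-refl c
  hasColour-edgeColour false = refl

  hasColour-edgeColour-≢ : ∀ {j} b → c ≢ j → hasColour (edgeColour c b) j ≡ 0
  hasColour-edgeColour-≢ true  c≢j = δ-≢ c≢j
  hasColour-edgeColour-≢ false c≢j = refl

  degC-monochrome : ∀ v → degC (monochrome c G) c v ≡ deg G v
  degC-monochrome v = sumFin-cong n (λ w → hasColour-edgeColour (adj G v w))

  degC-monochrome-≢ : ∀ {j} v → c ≢ j → degC (monochrome c G) j v ≡ 0
  degC-monochrome-≢ v c≢j = sumFin-zero n (λ w → hasColour-edgeColour-≢ (adj G v w) c≢j)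

  eC-monochrome : ∀ v → eC (monochrome c G) c v ≡ eN G v
  eC-monochrome v = sumFin²-cong n (λ x y →
    cong₂ _*_ (cong₂ _*_ (cong ((x <ᵢ y) *_) (inNC-monochrome v x)) (inNC-monochrome v y))
              (hasColour-edgeColour (adj G x y)))

  eC-monochrome-≢ : ∀ {j} v → c ≢ j → eC (monochrome c G) j v ≡ 0
  eC-monochrome-≢ v c≢j = sumFin-zero n (λ x → sumFin-zero n (λ y →
    trans (cong (P x y *_) (hasColour-edgeColour-≢ (adj G x y) c≢j)) (*-zeroʳ (P x y))))
    where
    P : Fin n → Fin n → ℕ
    P x y = (x <ᵢ y) * inNC (monochrome c G) v x * inNC (monochrome c G) v y

shift : ∀ {k n} → ColouredGraph k n → ColouredGraph (suc k) n
shift H = record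
  { col    = λ u v → Maybe.map suc (col H u v)
  ; sym    = λ u v → cong (Maybe.map suc) (ColouredGraph.sym H u v)
  ; irrefl = λ v → cong (Maybe.map suc) (ColouredGraph.irrefl H v)
  }

module _ {k n} (H : ColouredGraph k n) where

  hasColour-map-suc : ∀ (e : Maybe (Fin k)) j → hasColour (Maybe.map suc e) (suc j) ≡ hasColour e j
  hasColour-map-suc nothing  j = refl
  hasColour-map-suc (just c) j = δ-suc c j

  hasColour-map-suc-zero : ∀ (e : Maybe (Fin k)) → hasColour (Maybe.map suc e) zero ≡ 0
  hasColour-map-suc-zero nothing  = refl
  hasColour-map-suc-zero (just c) = refl

  isEdge-map-suc : ∀ (e : Maybe (Fin k)) → isEdge (Maybe.map suc e) ≡ isEdge e
  isEdge-map-suc nothing  = refl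
  isEdge-map-suc (just c) = refl

  inNC-shift : ∀ v u → inNC (shift H) v u ≡ inNC H v u
  inNC-shift v u = begin
    inNC (shift H) v u                        ≡⟨ inNC≡δ+isEdge (shift H) v u ⟩
    δ v u + isEdge (Maybe.map suc (col H v u)) ≡⟨ cong (δ v u +_) (isEdge-map-suc (col H v u)) ⟩
    δ v u + isEdge (col H v u)                 ≡⟨ inNC≡δ+isEdge H v u ⟨
    inNC H v u                                 ∎

  degC-shift : ∀ j v → degC (shift H) (suc j) v ≡ degC H j v
  degC-shift j v = sumFin-cong n (λ w → hasColour-map-suc (col H v w) j)

  degC-shift-zero : ∀ v → degC (shift H) zero v ≡ 0
  degC-shift-zero v = sumFin-zero n (λ w → hasColour-map-suc-zero (col H v w))

  eC-shift : ∀ j v → eC (shift H) (suc j) v ≡ eC H j v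
  eC-shift j v = sumFin²-cong n (λ x y →
    cong₂ _*_ (cong₂ _*_ (cong ((x <ᵢ y) *_) (inNC-shift v x)) (inNC-shift v y))
              (hasColour-map-suc (col H x y) j))

  eC-shift-zero : ∀ v → eC (shift H) zero v ≡ 0
  eC-shift-zero v = sumFin-zero n (λ x → sumFin-zero n (λ y →
    trans (cong (P x y *_) (hasColour-map-suc-zero (col H x y))) (*-zeroʳ (P x y))))
    where
    P : Fin n → Fin n → ℕ
    P x y = (x <ᵢ y) * inNC (shift H) v x * inNC (shift H) v y

withNewColour : ∀ {k m n} → Graph m → ColouredGraph k n → ColouredGraph (suc k) (m * n)
withNewColour G H = monochrome zero G □ shift H

module _ {k m n} (G : Graph m) (H : ColouredGraph k n) where

  degC-newColour : ∀ u → degC (withNewColour G H) zero u ≡ deg G (π₁ {m} n u)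
  degC-newColour u = begin
    degC (withNewColour G H) zero u                                 ≡⟨ degC-□ (monochrome zero G) (shift H) zero u ⟩
    degC (monochrome zero G) zero (π₁ {m} n u) + degC (shift H) zero (π₂ {m} n u)
      ≡⟨ cong₂ _+_ (degC-monochrome zero G (π₁ {m} n u)) (degC-shift-zero H (π₂ {m} n u)) ⟩
    deg G (π₁ {m} n u) + 0                                          ≡⟨ +-identityʳ _ ⟩
    deg G (π₁ {m} n u)                                              ∎

  degC-oldColour : ∀ j u → degC (withNewColour G H) (suc j) u ≡ degC H j (π₂ {m} n u)
  degC-oldColour j u = trans (degC-□ (monochrome zero G) (shift H) (suc j) u)
    (cong₂ _+_ (degC-monochrome-≢ zero G (π₁ {m} n u) (λ ())) (degC-shift H j (π₂ {m} n u)))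

  eC-newColour : ∀ u → eC (withNewColour G H) zero u ≡ eN G (π₁ {m} n u)
  eC-newColour u = trans (eC-□ (monochrome zero G) (shift H) zero u)
    (trans (cong₂ _+_ (eC-monochrome zero G (π₁ {m} n u)) (eC-shift-zero H (π₂ {m} n u))) (+-identityʳ _))

  eC-oldColour : ∀ j u → eC (withNewColour G H) (suc j) u ≡ eC H j (π₂ {m} n u)
  eC-oldColour j u = trans (eC-□ (monochrome zero G) (shift H) (suc j) u)
    (cong₂ _+_ (eC-monochrome-≢ zero G (π₁ {m} n u) (λ ())) (eC-shift H j (π₂ {m} n u)))

complete : ∀ n → Graph n
complete n = record
  { adj    = λ u v → not (does (u ≟F v))
  ; sym    = λ u v → cong not (≟-sym u v)
  ; irrefl = λ v → cong not (dec-true (v ≟F v) refl)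
  }
  where
  ≟-sym : ∀ (u v : Fin n) → does (u ≟F v) ≡ does (v ≟F u)
  ≟-sym u v with u ≟F v | v ≟F u
  ... | yes _   | yes _   = refl
  ... | no  _   | no  _   = refl
  ... | yes u≡v | no v≢u  = ⊥-elim (v≢u (sym u≡v))
  ... | no u≢v  | yes v≡u = ⊥-elim (u≢v (sym v≡u))

module _ (a : ℕ) where

  deg-complete : ∀ v → deg (complete (suc a)) v ≡ a
  deg-complete v = +-cancelʳ-≡ 1 _ _ (begin
    deg (complete (suc a)) v + 1
      ≡⟨ cong (deg (complete (suc a)) v +_) (sumFin-δ (suc a) v (λ _ → 1)) ⟨
    deg (complete (suc a)) v + sumFin (suc a) (λ w → δ v w * 1)
      ≡⟨ sumFin-+ (suc a) (λ w → bool (adj (complete (suc a)) v w)) (λ w → δ v w * 1) ⟨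
    sumFin (suc a) (λ w → bool (not (does (v ≟F w))) + ind (v ≟F w) * 1)
      ≡⟨ sumFin-cong (suc a) (λ w → complementary (v ≟F w)) ⟩
    sumFin (suc a) (λ _ → 1)
      ≡⟨ trans (sumFin-const (suc a) 1) (*-identityʳ (suc a)) ⟩
    suc a
      ≡⟨ +-comm 1 a ⟩
    a + 1 ∎)
    where
    complementary : ∀ {p} {P : Set p} (P? : Dec P) → bool (not (does P?)) + ind P? * 1 ≡ 1
    complementary (yes _) = refl
    complementary (no  _) = refl

  inN-complete : ∀ v x → inN (complete (suc a)) v x ≡ 1
  inN-complete v x with v ≟F x
  ... | yes _   = refl
  ... | no  v≢x = cong (bool ∘ not) (dec-false (v ≟F x) v≢x)

  eN-complete*2 : ∀ v → eN (complete (suc a)) v * 2 ≡ suc a * a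
  eN-complete*2 v = begin
    eN K v * 2
      ≡⟨ cong (_* 2) (sumFin²-cong (suc a) whole-neighbourhood) ⟩
    sumFin² (suc a) (λ x y → (x <ᵢ y) * E x y) * 2
      ≡⟨ sumFin²-<ᵢ (suc a) E (λ x y → cong bool (Graph.sym K x y)) (λ x → cong bool (Graph.irrefl K x)) ⟩
    sumFin (suc a) (deg K)
      ≡⟨ trans (sumFin-cong (suc a) deg-complete) (sumFin-const (suc a) a) ⟩
    suc a * a ∎
    where
    K = complete (suc a)
    E : Fin (suc a) → Fin (suc a) → ℕ
    E x y = bool (adj K x y)
    whole-neighbourhood : ∀ x y → (x <ᵢ y) * inN K v x * inN K v y * E x y ≡ (x <ᵢ y) * E x y
    whole-neighbourhood x y rewrite inN-complete v x | inN-complete v y =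
      cong (_* E x y) (trans (*-identityʳ ((x <ᵢ y) * 1)) (*-identityʳ (x <ᵢ y)))

[1+n]C2*2≡[1+n]*n : ∀ n → (suc n C 2) * 2 ≡ suc n * n
[1+n]C2*2≡[1+n]*n zero    = refl
[1+n]C2*2≡[1+n]*n (suc n) = begin
  (suc (suc n) C 2) * 2                 ≡⟨ cong (_* 2) (nCk+nC[k+1]≡[n+1]C[k+1] (suc n) 1) ⟨
  (suc n C 1 + suc n C 2) * 2           ≡⟨ cong (λ c → (c + suc n C 2) * 2) (nC1≡n (suc n)) ⟩
  (suc n + suc n C 2) * 2               ≡⟨ *-distribʳ-+ 2 (suc n) (suc n C 2) ⟩
  suc n * 2 + (suc n C 2) * 2           ≡⟨ cong (suc n * 2 +_) ([1+n]C2*2≡[1+n]*n n) ⟩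
  suc n * 2 + suc n * n                 ≡⟨ *-distribˡ-+ (suc n) 2 n ⟨
  suc n * (2 + n)                       ≡⟨ *-comm (suc n) (2 + n) ⟩
  suc (suc n) * suc n                   ∎

eN-complete : ∀ a v → eN (complete (suc a)) v ≡ suc a C 2
eN-complete a v = *-cancelʳ-≡ _ _ 2 (trans (eN-complete*2 a v) (sym ([1+n]C2*2≡[1+n]*n a)))

isFlip3-from-flipGraph : ∀ a₁ a₂ a₃ n (H : ColouredGraph 2 (suc n)) →
  (∀ v → degC H d₂ v ≡ a₂ × degC H d₃ v ≡ a₃) →
  (∀ v → eC H d₃ v < eC H d₂ v) →
  (∀ v → eC H d₂ v < suc a₁ C 2) →
  IsFlip3 a₁ a₂ a₃
isFlip3-from-flipGraph a₁ a₂ a₃ n H degH e₃<e₂ e₂<C = n + a₁ * suc n , P , degP , eP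
  where
  K = complete (suc a₁)
  P = withNewColour K H
  degP : ∀ u → degC P c₁ u ≡ a₁ × degC P c₂ u ≡ a₂ × degC P c₃ u ≡ a₃
  degP u = trans (degC-newColour K H u) (deg-complete a₁ (π₁ (suc n) u))
         , trans (degC-oldColour K H d₂ u) (proj₁ (degH (π₂ {suc a₁} (suc n) u)))
         , trans (degC-oldColour K H d₃ u) (proj₂ (degH (π₂ {suc a₁} (suc n) u)))
  eP : ∀ u → eC P c₃ u < eC P c₂ u × eC P c₂ u < eC P c₁ u
  eP u = subst₂ _<_ (sym e₃) (sym e₂) (e₃<e₂ h) , subst₂ _<_ (sym e₂) (sym e₁) (e₂<C h)
    where
    h = π₂ {suc a₁} (suc n) u
    e₁ : eC P c₁ u ≡ suc a₁ C 2
    e₁ = trans (eC-newColour K H u) (eN-complete a₁ (π₁ (suc n) u))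
    e₂ : eC P c₂ u ≡ eC H d₂ h
    e₂ = eC-oldColour K H d₂ u
    e₃ : eC P c₃ u ≡ eC H d₃ h
    e₃ = eC-oldColour K H d₃ u

isFlip3-from-regularGraphs : ∀ a₁ a₂ a₃ n₁ n₂ n₃
  (H₁ : Graph (suc n₁)) (H₂ : Graph (suc n₂)) (H₃ : Graph (suc n₃)) →
  Regular a₁ H₁ → Regular a₂ H₂ → Regular a₃ H₃ →
  (∀ u v → eN H₂ u < eN H₁ v) →
  (∀ u v → eN H₃ u < eN H₂ v) →
  IsFlip3 a₁ a₂ a₃
isFlip3-from-regularGraphs a₁ a₂ a₃ n₁ n₂ n₃ H₁ H₂ H₃ reg₁ reg₂ reg₃ e₂<e₁ e₃<e₂ =
  n₃ + n₂ * suc n₃ + n₁ * (suc n₂ * suc n₃) , P , degP , eP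
  where
  H₂₃ = withNewColour H₂ (monochrome zero H₃)
  P = withNewColour H₁ H₂₃
  module _ (u : Fin (suc n₁ * (suc n₂ * suc n₃))) where
    x = π₁ (suc n₂ * suc n₃) u
    yz = π₂ {suc n₁} (suc n₂ * suc n₃) u
    y = π₁ (suc n₃) yz
    z = π₂ {suc n₂} (suc n₃) yz
    degP : degC P c₁ u ≡ a₁ × degC P c₂ u ≡ a₂ × degC P c₃ u ≡ a₃
    degP = trans (degC-newColour H₁ H₂₃ u) (reg₁ x)
         , trans (degC-oldColour H₁ H₂₃ zero u) (trans (degC-newColour H₂ (monochrome zero H₃) yz) (reg₂ y))
         , trans (degC-oldColour H₁ H₂₃ (suc zero) u)
                 (trans (degC-oldColour H₂ (monochrome zero H₃) zero yz) (trans (degC-monochrome zero H₃ z) (reg₃ z)))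
    e₁ : eC P c₁ u ≡ eN H₁ x
    e₁ = eC-newColour H₁ H₂₃ u
    e₂ : eC P c₂ u ≡ eN H₂ y
    e₂ = trans (eC-oldColour H₁ H₂₃ zero u) (eC-newColour H₂ (monochrome zero H₃) yz)
    e₃ : eC P c₃ u ≡ eN H₃ z
    e₃ = trans (eC-oldColour H₁ H₂₃ (suc zero) u)
               (trans (eC-oldColour H₂ (monochrome zero H₃) zero yz) (eC-monochrome zero H₃ z))
    eP : eC P c₃ u < eC P c₂ u × eC P c₂ u < eC P c₁ u
    eP = subst₂ _<_ (sym e₃) (sym e₂) (e₃<e₂ z y) , subst₂ _<_ (sym e₂) (sym e₁) (e₂<e₁ y x)

proposition4p2 : (a₁ a₂ a₃ : ℕ) → 0 < a₁ → a₁ < a₂ → a₂ < a₃ →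
    ((n : ℕ) → (H : ColouredGraph 2 (suc n)) →
      (∀ v → degC H d₂ v ≡ a₂ × degC H d₃ v ≡ a₃) →
      (∀ v → eC H d₃ v < eC H d₂ v) →
      (∀ v → eC H d₂ v < (suc a₁) C 2) →
      IsFlip3 a₁ a₂ a₃)
  × ((n₁ n₂ n₃ : ℕ) → (H₁ : Graph (suc n₁)) → (H₂ : Graph (suc n₂)) → (H₃ : Graph (suc n₃)) →
      Regular a₁ H₁ → Regular a₂ H₂ → Regular a₃ H₃ →
      (∀ u v → eN H₂ u < eN H₁ v) →
      (∀ u v → eN H₃ u < eN H₂ v) →
      IsFlip3 a₁ a₂ a₃)
proposition4p2 a₁ a₂ a₃ _ _ _ = isFlip3-from-flipGraph a₁ a₂ a₃ , isFlip3-from-regularGraphs a₁ a₂ a₃
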